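{- For every $n\ge 2$, the number of path unfoldings of the $n$-cube (equivalently, spanning paths of the $n$-Roberts graph up to automorphism) equals the number of spanning paths of the $(n+1)$-Roberts graph whose two endpoints are antipodal vertices (up to automorphism).
   Context: The $m$-Roberts graph has $2m$ vertices arranged as $m$ antipodal pairs (corresponding to pairs of opposite facets of the $m$-cube), with every pair of vertices joined by an edge except antipodal pairs. A path unfolding of the $n$-cube is a ridge unfolding whose tree of uncut ridges (on the facets) is a path; these correspond to spanning paths of the $n$-Roberts graph. Counts are taken up to the symmetries of the cube (automorphisms of the Roberts graph). -}

module Defs where

open import Data.Nat using (ℕ)
open import Data.Fin using (Fin)
open import Data.Bool using (Bool; not)
open import Data.Product using (Σ; _×_; _,_; ∃)
open import Data.Sum using (_⊎_)
open import Data.List using (List; []; _∷_; _++_; map; reverse; [_])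
open import Data.List.Membership.Propositional using (_∈_)
open import Data.List.Relation.Unary.Unique.Propositional using (Unique)
open import Data.List.Relation.Unary.Linked using (Linked)
open import Function.Bundles using (_↔_; Inverse)
open import Relation.Nullary using (¬_)
open import Relation.Binary.PropositionalEquality using (_≡_)

-- Vertices of the m-Roberts graph: m antipodal pairs; (i , b) and (i , not b)
-- are the two (antipodal) vertices of pair i (a pair of opposite facets).
RVertex : ℕ → Set
RVertex m = Fin m × Bool

Adj : (m : ℕ) → RVertex m → RVertex m → Set
Adj m (i , _) (j , _) = ¬ (i ≡ j)

Antipodal : (m : ℕ) → RVertex m → RVertex m → Set
Antipodal m (i , b) (j , c) = (i ≡ j) × (c ≡ not b)

IsSpanningPath : (m : ℕ) → List (RVertex m) → Set
IsSpanningPath m p = Unique p × (∀ v → v ∈ p) × Linked (Adj m) p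

IsAntipodalSpanningPath : (m : ℕ) → List (RVertex m) → Set
IsAntipodalSpanningPath m p =
  IsSpanningPath m p ×
  Σ (RVertex m) λ u → Σ (RVertex m) λ w → Σ (List (RVertex m)) λ mid →
    (p ≡ u ∷ mid ++ [ w ]) × Antipodal m u w

-- Automorphisms of the m-Roberts graph (= symmetries of the m-cube).
record Automorphism (m : ℕ) : Set where
  field
    perm     : RVertex m ↔ RVertex m
    preserve : ∀ u v → Adj m u v → Adj m (Inverse.to perm u) (Inverse.to perm v)
    reflect  : ∀ u v → Adj m (Inverse.to perm u) (Inverse.to perm v) → Adj m u v

-- Two vertex sequences describe the same path up to automorphism
-- (a path is unoriented, so reversal is also identified).
EquivPath : (m : ℕ) → List (RVertex m) → List (RVertex m) → Set
EquivPath m p q = Σ (Automorphism m) λ σ →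
  (map (Inverse.to (Automorphism.perm σ)) p ≡ q)
  ⊎ (map (Inverse.to (Automorphism.perm σ)) p ≡ reverse q)

HasClassCount : {A : Set} → (A → Set) → (A → A → Set) → ℕ → Set
HasClassCount {A} P R k =
  Σ (Fin k → A) λ r →
    (∀ i → P (r i)) ×
    (∀ i j → R (r i) (r j) → i ≡ j) ×
    (∀ x → P x → ∃ λ i → R x (r i))

PathUnfoldingCount : ℕ → ℕ → Set
PathUnfoldingCount n k = HasClassCount (IsSpanningPath n) (EquivPath n) k

AntipodalPathCount : ℕ → ℕ → Set
AntipodalPathCount m k = HasClassCount (IsAntipodalSpanningPath m) (EquivPath m) k

module Submission where

-- The correspondence is bracketing: a spanning path p of the n-Roberts graph
-- becomes (0 , false) · p · (0 , true) in the (n+1)-Roberts graph, where the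
-- old pairs are renumbered 1 … n and 0 is the new pair.  Bracketing sends
-- spanning paths to spanning paths with antipodal endpoints, preserves and
-- reflects equivalence up to automorphism and reversal, and (after a
-- symmetry moving the endpoints into pair 0) reaches every antipodal
-- spanning path; so it transfers any class count (classCount-transfer).
--
-- To know that such a count exists at all, equivalence of paths must be
-- decidable.  This is done with a canonical form: relabel the pairs in order
-- of first appearance and record each vertex relative to the first-seen
-- vertex of its pair.  The canonical form is invariant under automorphisms,
-- and every path is carried onto its canonical form by a product of swaps,
-- so two paths are equivalent iff their canonical forms agree (up to
-- reversing one path).  Since spanning paths are duplicate-free lists over a
-- finite vertex set, a greedy pass over all candidates then counts classes.
-- The same canonical forms make the preservation and reflection of
-- equivalence under bracketing a computation.

open import Defs
open import Data.Nat using (ℕ; zero; suc; pred; _+_; _≤_; _<_; z≤n; s≤s; _≤?_)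
open import Data.Nat.Properties
  using (≤-trans; ≤-reflexive; ≤-<-trans; n≤1+n; ≰⇒>; <-irrefl; m<1+n⇒m<n∨m≡n; +-identityʳ; +-comm)
  renaming (_≟_ to _≟ℕ_)
open import Data.Fin using (Fin; toℕ; fromℕ<) renaming (zero to fzero; suc to fsuc)
open import Data.Fin.Properties
  using (toℕ-injective; toℕ<n; toℕ-fromℕ<; any?) renaming (_≟_ to _≟F_; suc-injective to fsuc-injective)
open import Data.Fin.Permutation using (Permutation′; _⟨$⟩ʳ_; _⟨$⟩ˡ_; inverseˡ; inverseʳ; transpose)
open import Data.Bool using (Bool; true; false; not; _∧_; _xor_; if_then_else_)
open import Data.Bool.Properties
  using (xor-assoc; xor-same; xor-inverseʳ; ∧-identityʳ; ∧-zeroʳ; not-¬) renaming (_≟_ to _≟B_)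
open import Data.Product using (Σ; _×_; _,_; ∃; proj₁; proj₂; map₁; map₂)
open import Data.Product.Properties using (≡-dec)
open import Data.Sum using (_⊎_; inj₁; inj₂; [_,_]′)
open import Data.Empty using (⊥-elim)
open import Data.Maybe using (Maybe; just; nothing)
import Data.Maybe as Maybe
open import Data.List
  using (List; []; _∷_; _++_; map; reverse; [_]; length; _∷ʳ_; cartesianProduct; cartesianProductWith; allFin)
open import Data.List.Properties
  using (map-∘; map-id; map-cong; map-++; map-injective; length-map; length-++; length-removeAt′;
         reverse-map; reverse-involutive; unfold-reverse; reverse-++; ∷-injectiveʳ; ∷ʳ-injectiveˡ)
  renaming (≡-dec to ≡-dec-List)
open import Data.List.Membership.Propositional using (_∈_; _─_)
open import Data.List.Membership.Propositional.Properties
  using (∈-map⁺; ∈-map⁻; ∈-++⁻; ∈-++⁺ˡ; ∈-++⁺ʳ; ∈-cartesianProductWith⁺; ∈-allFin)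
open import Data.List.Relation.Unary.Any using (here; there)
import Data.List.Relation.Unary.Any as Any
open import Data.List.Relation.Unary.All using (All; []; _∷_)
import Data.List.Relation.Unary.All as All
import Data.List.Relation.Unary.All.Properties as AllP
open import Data.List.Relation.Unary.AllPairs using ([]; _∷_; allPairs?)
open import Data.List.Relation.Unary.Linked using (Linked; []; [-]; _∷_; linked?)
import Data.List.Relation.Unary.Linked as Linked
import Data.List.Relation.Unary.Linked.Properties as LinkedP
open import Data.List.Relation.Unary.Unique.Propositional using (Unique)
import Data.List.Relation.Unary.Unique.Propositional.Properties as UniqueP
import Data.Vec.Functional as Vector
open import Function.Bundles using (Inverse; mk↔ₛ′; mk⇔)
open import Relation.Nullary using (¬_; Dec; yes; no; does)
open import Relation.Nullary.Decidable using (dec-true; dec-false; decidable-stable; does-⇔; _×-dec_; ¬?)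
open import Relation.Binary.PropositionalEquality hiding ([_])
open ≡-Reasoning

V : ℕ → Set
V = RVertex

pair : ∀ {m} → V m → Fin m
pair = proj₁

_≟V_ : ∀ {m} (u v : V m) → Dec (u ≡ v)
_≟V_ = ≡-dec _≟F_ _≟B_

xor-cancelˡ : ∀ b c → b xor (b xor c) ≡ c
xor-cancelˡ b c = trans (sym (xor-assoc b b c)) (cong (_xor c) (xor-same b))

module _ {m : ℕ} (σ : Automorphism m) where

  apply unapply : V m → V m
  apply   = Inverse.to (Automorphism.perm σ)
  unapply = Inverse.from (Automorphism.perm σ)

  apply-unapply : ∀ v → apply (unapply v) ≡ v
  apply-unapply = Inverse.strictlyInverseˡ (Automorphism.perm σ)

  unapply-apply : ∀ v → unapply (apply v) ≡ v
  unapply-apply = Inverse.strictlyInverseʳ (Automorphism.perm σ)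

  apply-injective : ∀ {u v} → apply u ≡ apply v → u ≡ v
  apply-injective {u} {v} e = begin
    u                 ≡⟨ sym (unapply-apply u) ⟩
    unapply (apply u) ≡⟨ cong unapply e ⟩
    unapply (apply v) ≡⟨ unapply-apply v ⟩
    v                 ∎

  -- Non-adjacency means lying in the same pair, so an automorphism maps pairs
  -- to pairs; both directions follow by decidability of equality on Fin.
  samePair-preserved : ∀ u v → pair u ≡ pair v → pair (apply u) ≡ pair (apply v)
  samePair-preserved u v e =
    decidable-stable (pair (apply u) ≟F pair (apply v)) (λ ne → Automorphism.reflect σ u v ne e)

  samePair-reflected : ∀ u v → pair (apply u) ≡ pair (apply v) → pair u ≡ pair v
  samePair-reflected u v e =
    decidable-stable (pair u ≟F pair v) (λ ne → Automorphism.preserve σ u v ne e)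

mkAut : ∀ {m} (f g : V m → V m) → (∀ v → f (g v) ≡ v) → (∀ v → g (f v) ≡ v) →
  (∀ u v → pair u ≡ pair v → pair (f u) ≡ pair (f v)) →
  (∀ u v → pair (f u) ≡ pair (f v) → pair u ≡ pair v) → Automorphism m
mkAut f g fg gf pairs-preserved pairs-reflected = record
  { perm     = mk↔ₛ′ f g fg gf
  ; preserve = λ u v adj e → adj (pairs-reflected u v e)
  ; reflect  = λ u v adj e → adj (pairs-preserved u v e)
  }

idAut : ∀ {m} → Automorphism m
idAut = mkAut (λ v → v) (λ v → v) (λ _ → refl) (λ _ → refl) (λ _ _ e → e) (λ _ _ e → e)

_⨾_ : ∀ {m} → Automorphism m → Automorphism m → Automorphism m
σ ⨾ τ = mkAut (λ v → apply τ (apply σ v)) (λ v → unapply σ (unapply τ v))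
  (λ v → trans (cong (apply τ) (apply-unapply σ _)) (apply-unapply τ v))
  (λ v → trans (cong (unapply σ) (unapply-apply τ _)) (unapply-apply σ v))
  (λ u v e → samePair-preserved τ _ _ (samePair-preserved σ u v e))
  (λ u v e → samePair-reflected σ u v (samePair-reflected τ _ _ e))

inverseAut : ∀ {m} → Automorphism m → Automorphism m
inverseAut σ = mkAut (unapply σ) (apply σ) (unapply-apply σ) (apply-unapply σ)
  (λ u v e → samePair-reflected σ _ _
    (subst₂ (λ a b → pair a ≡ pair b) (sym (apply-unapply σ u)) (sym (apply-unapply σ v)) e))
  (λ u v e → subst₂ (λ a b → pair a ≡ pair b) (apply-unapply σ u) (apply-unapply σ v)
    (samePair-preserved σ _ _ e))

signedPerm : ∀ {m} → Permutation′ m → (Fin m → Bool) → Automorphism m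
signedPerm {m} π s = mkAut f g fg gf (λ u v e → cong (π ⟨$⟩ʳ_) e) (λ u v → π-injective)
  where
  f g : V m → V m
  f (j , b) = π ⟨$⟩ʳ j , s j xor b
  g (k , b) = π ⟨$⟩ˡ k , s (π ⟨$⟩ˡ k) xor b
  fg : ∀ v → f (g v) ≡ v
  fg (k , b) = cong₂ _,_ (inverseʳ π) (xor-cancelˡ (s (π ⟨$⟩ˡ k)) b)
  gf : ∀ v → g (f v) ≡ v
  gf (j , b) = cong₂ _,_ (inverseˡ π)
    (trans (cong (λ i → s i xor (s j xor b)) (inverseˡ π)) (xor-cancelˡ (s j) b))
  π-injective : ∀ {i j} → π ⟨$⟩ʳ i ≡ π ⟨$⟩ʳ j → i ≡ j
  π-injective {i} {j} e = trans (sym (inverseˡ π)) (trans (cong (π ⟨$⟩ˡ_) e) (inverseˡ π))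

swapAut : ∀ {m} → Fin m → Fin m → Bool → Automorphism m
swapAut i c b = signedPerm (transpose i c) (λ j → b ∧ does (j ≟F i))

swap-moves : ∀ {m} (i c : Fin m) b b′ → apply (swapAut i c b) (i , b′) ≡ (c , b xor b′)
swap-moves i c b b′ rewrite dec-true (i ≟F i) refl = cong (λ s → c , s xor b′) (∧-identityʳ b)

swap-fixes : ∀ {m} (i c : Fin m) b {j} b′ → ¬ j ≡ i → ¬ j ≡ c → apply (swapAut i c b) (j , b′) ≡ (j , b′)
swap-fixes i c b {j} b′ j≢i j≢c rewrite dec-false (j ≟F i) j≢i | dec-false (j ≟F c) j≢c =
  cong (λ s → j , s xor b′) (∧-zeroʳ b)

map-unapply-apply : ∀ {m} (σ : Automorphism m) xs → map (unapply σ) (map (apply σ) xs) ≡ xs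
map-unapply-apply σ xs = begin
  map (unapply σ) (map (apply σ) xs)    ≡⟨ sym (map-∘ xs) ⟩
  map (λ v → unapply σ (apply σ v)) xs  ≡⟨ map-cong (unapply-apply σ) xs ⟩
  map (λ v → v) xs                      ≡⟨ map-id xs ⟩
  xs                                    ∎

equiv-refl : ∀ {m} (x : List (V m)) → EquivPath m x x
equiv-refl x = idAut , inj₁ (map-id x)

equiv-unreverse : ∀ {m} {x y : List (V m)} → EquivPath m x (reverse y) → EquivPath m x y
equiv-unreverse (σ , inj₁ e) = σ , inj₂ e
equiv-unreverse {y = y} (σ , inj₂ e) = σ , inj₁ (trans e (reverse-involutive y))

equiv-sym : ∀ {m} {x y : List (V m)} → EquivPath m x y → EquivPath m y x
equiv-sym {x = x} (σ , inj₁ e) =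
  inverseAut σ , inj₁ (trans (cong (map (unapply σ)) (sym e)) (map-unapply-apply σ x))
equiv-sym {x = x} {y} (σ , inj₂ e) = inverseAut σ , inj₂ (begin
  map (unapply σ) y                      ≡⟨ sym (reverse-involutive _) ⟩
  reverse (reverse (map (unapply σ) y))  ≡⟨ cong reverse (sym (reverse-map (unapply σ) y)) ⟩
  reverse (map (unapply σ) (reverse y))  ≡⟨ cong (λ z → reverse (map (unapply σ) z)) (sym e) ⟩
  reverse (map (unapply σ) (map (apply σ) x)) ≡⟨ cong reverse (map-unapply-apply σ x) ⟩
  reverse x                              ∎)

equiv-trans : ∀ {m} {x y z : List (V m)} → EquivPath m x y → EquivPath m y z → EquivPath m x z
equiv-trans {x = x} {y} {z} (σ , e₁) (τ , e₂) = σ ⨾ τ , combine e₁ e₂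
  where
  στx : map (apply (σ ⨾ τ)) x ≡ map (apply τ) (map (apply σ) x)
  στx = map-∘ x
  τ-rev : ∀ {w} → map (apply τ) y ≡ w → map (apply τ) (reverse y) ≡ reverse w
  τ-rev e = trans (reverse-map (apply τ) y) (cong reverse e)
  combine : map (apply σ) x ≡ y ⊎ map (apply σ) x ≡ reverse y →
            map (apply τ) y ≡ z ⊎ map (apply τ) y ≡ reverse z →
            map (apply (σ ⨾ τ)) x ≡ z ⊎ map (apply (σ ⨾ τ)) x ≡ reverse z
  combine (inj₁ a) (inj₁ b) = inj₁ (trans στx (trans (cong (map (apply τ)) a) b))
  combine (inj₁ a) (inj₂ b) = inj₂ (trans στx (trans (cong (map (apply τ)) a) b))
  combine (inj₂ a) (inj₁ b) = inj₂ (trans στx (trans (cong (map (apply τ)) a) (τ-rev b)))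
  combine (inj₂ a) (inj₂ b) =
    inj₁ (trans στx (trans (cong (map (apply τ)) a) (trans (τ-rev b) (reverse-involutive z))))

spanning-apply : ∀ {m} (σ : Automorphism m) p → IsSpanningPath m p → IsSpanningPath m (map (apply σ) p)
spanning-apply σ p (unique , covers , linked) =
  UniqueP.map⁺ (apply-injective σ) unique ,
  (λ v → subst (_∈ map (apply σ) p) (apply-unapply σ v) (∈-map⁺ (apply σ) (covers (unapply σ v)))) ,
  LinkedP.map⁺ (Linked.map (λ {u} {v} → Automorphism.preserve σ u v) linked)

-- Canonical forms.

firstInPair : ∀ {m} → V m → List (V m) → Maybe (ℕ × V m)
firstInPair v [] = nothing
firstInPair v (s ∷ ss) =
  if does (pair v ≟F pair s) then just (0 , s) else Maybe.map (map₁ suc) (firstInPair v ss)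

-- The pairs get labels 0, 1, 2, … in order of first
-- appearance (`seen` holds the first-seen vertex of each pair); a vertex is
-- encoded as the label of its pair and whether it differs from that first vertex.
encodeStep : ∀ {m} → List (V m) → V m → Maybe (ℕ × V m) → (ℕ × Bool) × List (V m)
encodeStep seen x (just (j , s)) = (j , not (does (x ≟V s))) , seen
encodeStep seen x nothing        = (length seen , false) , seen ++ [ x ]

canonFrom : ∀ {m} → List (V m) → List (V m) → List (ℕ × Bool)
canonFrom seen []       = []
canonFrom seen (x ∷ xs) =
  proj₁ (encodeStep seen x (firstInPair x seen)) ∷
  canonFrom (proj₂ (encodeStep seen x (firstInPair x seen))) xs

-- The canonical form of a vertex sequence: it forgets the names of the pairs
-- and the orientation of each pair.
canon : ∀ {m} → List (V m) → List (ℕ × Bool)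
canon = canonFrom []

-- The encoding only sees which vertices share a pair and which coincide, so it
-- is invariant under any injective map that preserves and reflects pairs
-- (automorphisms, but also the embedding of a smaller Roberts graph).
module Relabel {m m′} (f : V m → V m′)
  (pairs-preserved : ∀ u v → pair u ≡ pair v → pair (f u) ≡ pair (f v))
  (pairs-reflected : ∀ u v → pair (f u) ≡ pair (f v) → pair u ≡ pair v)
  (f-injective : ∀ {u v} → f u ≡ f v → u ≡ v) where

  firstInPair-map : ∀ v ss → firstInPair (f v) (map f ss) ≡ Maybe.map (map₂ f) (firstInPair v ss)
  firstInPair-map v [] = refl
  firstInPair-map v (s ∷ ss)
    rewrite does-⇔ (mk⇔ (pairs-reflected v s) (pairs-preserved v s))
                   (pair (f v) ≟F pair (f s)) (pair v ≟F pair s)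
    with does (pair v ≟F pair s)
  ... | true  = refl
  ... | false rewrite firstInPair-map v ss with firstInPair v ss
  ...   | just _  = refl
  ...   | nothing = refl

  encodeStep-map : ∀ seen x r →
    encodeStep (map f seen) (f x) (Maybe.map (map₂ f) r) ≡ map₂ (map f) (encodeStep seen x r)
  encodeStep-map seen x (just (j , s))
    rewrite does-⇔ (mk⇔ f-injective (cong f)) (f x ≟V f s) (x ≟V s) = refl
  encodeStep-map seen x nothing rewrite length-map f seen | map-++ f seen [ x ] = refl

  canonFrom-map : ∀ seen xs → canonFrom (map f seen) (map f xs) ≡ canonFrom seen xs
  canonFrom-map seen [] = refl
  canonFrom-map seen (x ∷ xs)
    rewrite firstInPair-map x seen | encodeStep-map seen x (firstInPair x seen) =
    cong (_ ∷_) (canonFrom-map _ xs)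

canon-apply : ∀ {m} (σ : Automorphism m) xs → canon (map (apply σ) xs) ≡ canon xs
canon-apply σ = Relabel.canonFrom-map (apply σ) (samePair-preserved σ) (samePair-reflected σ)
  (apply-injective σ) []

firstInPair-++-just : ∀ {m} (v : V m) ss ts {r} →
  firstInPair v ss ≡ just r → firstInPair v (ss ++ ts) ≡ just r
firstInPair-++-just v (s ∷ ss) ts found with does (pair v ≟F pair s)
... | true = found
... | false with firstInPair v ss in e
...   | just _ rewrite firstInPair-++-just v ss ts e = found

firstInPair-++-nothing : ∀ {m} (v : V m) ss ts → firstInPair v ss ≡ nothing →
  firstInPair v (ss ++ ts) ≡ Maybe.map (map₁ (length ss +_)) (firstInPair v ts)
firstInPair-++-nothing v [] ts _ with firstInPair v ts
... | just _  = refl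
... | nothing = refl
firstInPair-++-nothing v (s ∷ ss) ts _ with does (pair v ≟F pair s)
... | false with firstInPair v ss in e
...   | nothing rewrite firstInPair-++-nothing v ss ts e with firstInPair v ts
...     | just _  = refl
...     | nothing = refl

reps : ∀ {m} → List (Fin m) → List (V m)
reps = map (_, false)

data Labels {m : ℕ} : List (Fin m) → ℕ → Set where
  none : Labels [] 0
  next : ∀ {S c i} → Labels S c → toℕ i ≡ c → Labels (S ++ [ i ]) (suc c)

labels-length : ∀ {m} {S : List (Fin m)} {c} → Labels S c → length (reps S) ≡ c
labels-length none = refl
labels-length (next {S} {c} {i} L _) = begin
  length (reps (S ++ [ i ]))           ≡⟨ cong length (map-++ (_, false) S [ i ]) ⟩
  length (reps S ++ [ (i , false) ])   ≡⟨ length-++ (reps S) ⟩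
  length (reps S) + 1                  ≡⟨ +-comm (length (reps S)) 1 ⟩
  suc (length (reps S))                ≡⟨ cong suc (labels-length L) ⟩
  suc c                                ∎

firstInPair-unseen : ∀ {m} {S : List (Fin m)} {c} → Labels S c → ∀ i b →
  c ≤ toℕ i → firstInPair (i , b) (reps S) ≡ nothing
firstInPair-unseen none i b _ = refl
firstInPair-unseen (next {S} {c} {i′} L e) i b c<i
  rewrite map-++ (_, false) S [ i′ ]
        | firstInPair-++-nothing (i , b) (reps S) [ (i′ , false) ]
            (firstInPair-unseen L i b (≤-trans (n≤1+n c) c<i))
        | dec-false (i ≟F i′) (λ i≡i′ → <-irrefl (trans (sym e) (cong toℕ (sym i≡i′))) c<i) = refl

firstInPair-seen : ∀ {m} {S : List (Fin m)} {c} → Labels S c → ∀ i b →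
  toℕ i < c → firstInPair (i , b) (reps S) ≡ just (toℕ i , (i , false))
firstInPair-seen (next {S} {c} {i′} L e) i b i<1+c
  rewrite map-++ (_, false) S [ i′ ] with m<1+n⇒m<n∨m≡n i<1+c
... | inj₁ i<c = firstInPair-++-just (i , b) (reps S) _ (firstInPair-seen L i b i<c)
... | inj₂ i≡c with toℕ-injective (trans i≡c (sym e))
... | refl
  rewrite firstInPair-++-nothing (i , b) (reps S) [ (i , false) ]
            (firstInPair-unseen L i b (≤-reflexive (sym i≡c)))
        | dec-true (i ≟F i) refl =
  cong (λ k → just (k , (i , false)))
    (trans (+-identityʳ _) (trans (labels-length L) (sym i≡c)))

sign-relative : ∀ {m} (i : Fin m) b → not (does ((i , b) ≟V (i , false))) ≡ b
sign-relative i true  rewrite dec-false ((i , true) ≟V (i , false)) (λ ()) = refl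
sign-relative i false rewrite dec-true ((i , false) ≟V (i , false)) refl = refl

enc : ∀ {m} → V m → ℕ × Bool
enc (i , b) = toℕ i , b

enc-injective : ∀ {m} {u v : V m} → enc u ≡ enc v → u ≡ v
enc-injective {u = i , b} {j , c} e with toℕ-injective (cong proj₁ e) | cong proj₂ e
... | refl | refl = refl

-- `NormalFrom c xs`: xs is in normal form when the pairs 0 … c − 1 have already
-- been introduced: each new pair is the next one, c, entered at its vertex (c , false).
data NormalFrom {m : ℕ} (c : ℕ) : List (V m) → Set where
  end : NormalFrom c []
  old : ∀ {i b xs} → toℕ i < c → NormalFrom c xs → NormalFrom c ((i , b) ∷ xs)
  new : ∀ {i xs} → toℕ i ≡ c → NormalFrom (suc c) xs → NormalFrom c ((i , false) ∷ xs)

canonFrom-normal : ∀ {m} {S : List (Fin m)} {c} {xs : List (V m)} →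
  Labels S c → NormalFrom c xs → canonFrom (reps S) xs ≡ map enc xs
canonFrom-normal L end = refl
canonFrom-normal L (old {i} {b} i<c N) rewrite firstInPair-seen L i b i<c =
  cong₂ _∷_ (cong (toℕ i ,_) (sign-relative i b)) (canonFrom-normal L N)
canonFrom-normal {S = S} L (new {i} e N)
  rewrite firstInPair-unseen L i false (≤-reflexive (sym e)) =
  cong₂ _∷_ (cong (_, false) (trans (labels-length L) (sym e)))
    (trans (cong (λ seen → canonFrom seen _) (sym (map-++ (_, false) S [ i ])))
           (canonFrom-normal (next L e) N))

FixesBelow : ∀ {m} → ℕ → Automorphism m → Set
FixesBelow c σ = ∀ j b → toℕ j < c → apply σ (j , b) ≡ (j , b)

Normalisable : ∀ {m} → ℕ → List (V m) → Set
Normalisable {m} c ys = Σ (Automorphism m) λ σ → FixesBelow c σ × NormalFrom c (map (apply σ) ys)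

-- Every sequence is normalisable: a vertex (i , b) of a new pair is moved to
-- (c , false) by swapAut i c b, which fixes the pairs below c.  Normalising
-- `map (apply ρ) xs` for an arbitrary ρ keeps the recursion structural on xs.
normalise : ∀ {m} (xs : List (V m)) (ρ : Automorphism m) (c : ℕ) → Normalisable c (map (apply ρ) xs)
normalise [] ρ c = idAut , (λ _ _ _ → refl) , end
normalise {m} (x ∷ xs) ρ c with apply ρ x
... | i , b with c ≤? toℕ i
...   | no c≰i with normalise xs ρ c
...     | σ , fixes , N = σ , fixes , subst (λ v → NormalFrom c (v ∷ _)) (sym (fixes i b i<c)) (old i<c N)
  where
  i<c : toℕ i < c
  i<c = ≰⇒> c≰i
normalise {m} (x ∷ xs) ρ c | i , b | yes c≤i =
  enter (fromℕ< (≤-<-trans c≤i (toℕ<n i))) (toℕ-fromℕ< _)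
  where
  enter : (c′ : Fin m) → toℕ c′ ≡ c → Normalisable c ((i , b) ∷ map (apply ρ) xs)
  enter c′ c′≡c with normalise xs (ρ ⨾ swapAut i c′ b) (suc c)
  ... | σ′ , fixes′ , N′ = τ ⨾ σ′ , fixes , subst (NormalFrom c) (cong₂ _∷_ head tail) (new c′≡c N′)
    where
    τ : Automorphism m
    τ = swapAut i c′ b
    fixes : FixesBelow c (τ ⨾ σ′)
    fixes j b′ j<c = trans (cong (apply σ′) (swap-fixes i c′ b b′ j≢i j≢c′)) (fixes′ j b′ (≤-trans j<c (n≤1+n c)))
      where
      j≢i : ¬ j ≡ i
      j≢i refl = <-irrefl refl (≤-trans j<c c≤i)
      j≢c′ : ¬ j ≡ c′
      j≢c′ refl = <-irrefl c′≡c j<c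
    head : (c′ , false) ≡ apply (τ ⨾ σ′) (i , b)
    head = sym (begin
      apply σ′ (apply τ (i , b)) ≡⟨ cong (apply σ′) (swap-moves i c′ b b) ⟩
      apply σ′ (c′ , b xor b)    ≡⟨ cong (λ s → apply σ′ (c′ , s)) (xor-same b) ⟩
      apply σ′ (c′ , false)      ≡⟨ fixes′ c′ false (s≤s (≤-reflexive c′≡c)) ⟩
      (c′ , false)               ∎)
    tail : map (apply σ′) (map (apply (ρ ⨾ τ)) xs) ≡ map (apply (τ ⨾ σ′)) (map (apply ρ) xs)
    tail = begin
      map (apply σ′) (map (apply (ρ ⨾ τ)) xs)             ≡⟨ cong (map (apply σ′)) (map-∘ xs) ⟩
      map (apply σ′) (map (apply τ) (map (apply ρ) xs))   ≡⟨ sym (map-∘ (map (apply ρ) xs)) ⟩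
      map (apply (τ ⨾ σ′)) (map (apply ρ) xs)             ∎

canon-realised : ∀ {m} (xs : List (V m)) → Σ (Automorphism m) λ σ → map enc (map (apply σ) xs) ≡ canon xs
canon-realised xs with normalise xs idAut 0
... | σ , _ , N = σ , (begin
  map enc (map (apply σ) xs)             ≡⟨ sym (canonFrom-normal none N′) ⟩
  canon (map (apply σ) xs)               ≡⟨ canon-apply σ xs ⟩
  canon xs                               ∎)
  where
  N′ : NormalFrom 0 (map (apply σ) xs)
  N′ = subst (λ ys → NormalFrom 0 (map (apply σ) ys)) (map-id xs) N

sameCanon⇒equiv : ∀ {m} {x y : List (V m)} → canon x ≡ canon y → EquivPath m x y
sameCanon⇒equiv {x = x} {y} same with canon-realised x | canon-realised y
... | σ , σx | τ , τy = σ ⨾ inverseAut τ , inj₁ (begin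
  map (apply (σ ⨾ inverseAut τ)) x     ≡⟨ map-∘ x ⟩
  map (unapply τ) (map (apply σ) x)    ≡⟨ cong (map (unapply τ)) σx≡τy ⟩
  map (unapply τ) (map (apply τ) y)    ≡⟨ map-unapply-apply τ y ⟩
  y                                    ∎)
  where
  σx≡τy : map (apply σ) x ≡ map (apply τ) y
  σx≡τy = map-injective enc-injective (trans σx (trans same (sym τy)))

CanonMatch : ∀ {m} → List (V m) → List (V m) → Set
CanonMatch x y = canon x ≡ canon y ⊎ canon x ≡ canon (reverse y)

canon⇒equiv : ∀ {m} {x y : List (V m)} → CanonMatch x y → EquivPath m x y
canon⇒equiv (inj₁ e) = sameCanon⇒equiv e
canon⇒equiv (inj₂ e) = equiv-unreverse (sameCanon⇒equiv e)

equiv⇒canon : ∀ {m} {x y : List (V m)} → EquivPath m x y → CanonMatch x y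
equiv⇒canon {x = x} (σ , inj₁ e) = inj₁ (trans (sym (canon-apply σ x)) (cong canon e))
equiv⇒canon {x = x} (σ , inj₂ e) = inj₂ (trans (sym (canon-apply σ x)) (cong canon e))

_≟canon_ : (c d : List (ℕ × Bool)) → Dec (c ≡ d)
_≟canon_ = ≡-dec-List (≡-dec _≟ℕ_ _≟B_)

equivPath? : ∀ {m} (x y : List (V m)) → Dec (EquivPath m x y)
equivPath? x y with canon x ≟canon canon y | canon x ≟canon canon (reverse y)
... | yes e | _     = yes (canon⇒equiv (inj₁ e))
... | no _  | yes e = yes (canon⇒equiv (inj₂ e))
... | no a  | no b  = no (λ r → [ a , b ]′ (equiv⇒canon r))

-- If P and an equivalence-like R are decidable and every
-- P-element occurs in a finite list L, a greedy pass over L picks one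
-- representative from each class, so the classes can be counted.
module ClassCounting {A : Set} (P : A → Set) (R : A → A → Set)
  (P? : ∀ x → Dec (P x)) (R? : ∀ x y → Dec (R x y))
  (R-refl : ∀ x → R x x) (R-sym : ∀ {x y} → R x y → R y x) where

  Distinct : (k : ℕ) → (Fin k → A) → Set
  Distinct k r = (∀ i → P (r i)) × (∀ i j → R (r i) (r j) → i ≡ j)

  Covered : ∀ {k} → (Fin k → A) → A → Set
  Covered r x = ∃ λ i → R x (r i)

  Extension : List A → ∀ {k} → (Fin k → A) → Set
  Extension L r = Σ ℕ λ k′ → Σ (Fin k′ → A) λ r′ → Distinct k′ r′ ×
    (∀ x → Covered r x → Covered r′ x) × (∀ x → x ∈ L → P x → Covered r′ x)

  skip : ∀ {x L k} {r : Fin k → A} → (P x → Covered r x) → Extension L r → Extension (x ∷ L) r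
  skip {x} {L} {r = r} covers-x (k′ , r′ , d′ , mono , covers) = k′ , r′ , d′ , mono , covers′
    where
    covers′ : ∀ y → y ∈ x ∷ L → P y → Covered r′ y
    covers′ y (here refl) py = mono y (covers-x py)
    covers′ y (there y∈L) py = covers y y∈L py

  distinct-∷ : ∀ {x k} {r : Fin k → A} → P x → ¬ Covered r x → Distinct k r → Distinct (suc k) (x Vector.∷ r)
  distinct-∷ {r = r} px uncovered (rP , rD) = P-reps , injective
    where
    P-reps : ∀ i → P ((_ Vector.∷ r) i)
    P-reps fzero    = px
    P-reps (fsuc i) = rP i
    injective : ∀ i j → R ((_ Vector.∷ r) i) ((_ Vector.∷ r) j) → i ≡ j
    injective fzero    fzero    _ = refl
    injective fzero    (fsuc j) h = ⊥-elim (uncovered (j , h))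
    injective (fsuc i) fzero    h = ⊥-elim (uncovered (i , R-sym h))
    injective (fsuc i) (fsuc j) h = cong fsuc (rD i j h)

  add : ∀ {x L k} {r : Fin k → A} → Extension L (x Vector.∷ r) → Extension (x ∷ L) r
  add {x} {L} (k′ , r′ , d′ , mono , covers) =
    k′ , r′ , d′ , (λ y (i , h) → mono y (fsuc i , h)) , covers′
    where
    covers′ : ∀ y → y ∈ x ∷ L → P y → Covered r′ y
    covers′ y (here refl) py = mono y (fzero , R-refl x)
    covers′ y (there y∈L) py = covers y y∈L py

  extend : (L : List A) {k : ℕ} (r : Fin k → A) → Distinct k r → Extension L r
  extend [] r d = _ , r , d , (λ _ c → c) , (λ _ ())
  extend (x ∷ L) r d with P? x | any? (λ i → R? x (r i))
  ... | yes px | no uncovered = add (extend L (x Vector.∷ r) (distinct-∷ px uncovered d))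
  ... | yes _  | yes covered  = skip (λ _ → covered) (extend L r d)
  ... | no ¬px | _            = skip (λ px → ⊥-elim (¬px px)) (extend L r d)

  classCount : (L : List A) → (∀ x → P x → x ∈ L) → ∃ λ k → HasClassCount P R k
  classCount L complete with extend L {0} (λ ()) ((λ ()) , (λ ()))
  ... | k , r , (rP , rD) , _ , covers = k , r , rP , rD , λ x px → covers x (complete x px) px

classCount-transfer : ∀ {A B : Set} {P : A → Set} {Q : B → Set} {R : A → A → Set} {S : B → B → Set}
  (f : A → B) → (∀ a → P a → Q (f a)) →
  (∀ a a′ → S (f a) (f a′) → R a a′) → (∀ a a′ → R a a′ → S (f a) (f a′)) →
  (∀ b → Q b → ∃ λ a → P a × S b (f a)) → (∀ {x y z} → S x y → S y z → S x z) →
  ∀ {k} → HasClassCount P R k → HasClassCount Q S k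
classCount-transfer {Q = Q} {S = S} f PQ reflects preserves reaches S-trans (r , rP , rD , rC) =
  (λ i → f (r i)) , (λ i → PQ (r i) (rP i)) , (λ i j s → rD i j (reflects (r i) (r j) s)) , covers
  where
  covers : ∀ b → Q b → ∃ λ i → S b (f (r i))
  covers b qb with reaches b qb
  ... | a , pa , s with rC a pa
  ...   | i , ra = i , S-trans s (preserves a (r i) ra)

-- Finiteness of the spanning paths: they are duplicate-free, hence among the
-- lists of length at most 2m over the vertices.

allVertices : ∀ m → List (V m)
allVertices m = cartesianProduct (allFin m) (false ∷ true ∷ [])

∈-allVertices : ∀ {m} (v : V m) → v ∈ allVertices m
∈-allVertices (i , false) = ∈-cartesianProductWith⁺ _,_ (∈-allFin i) (here refl)
∈-allVertices (i , true)  = ∈-cartesianProductWith⁺ _,_ (∈-allFin i) (there (here refl))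

listsUpTo : ∀ {A : Set} → List A → ℕ → List (List A)
listsUpTo U zero    = [] ∷ []
listsUpTo U (suc k) = [] ∷ cartesianProductWith _∷_ U (listsUpTo U k)

∈-listsUpTo : ∀ {A : Set} (U : List A) k (xs : List A) →
  length xs ≤ k → (∀ {x} → x ∈ xs → x ∈ U) → xs ∈ listsUpTo U k
∈-listsUpTo U zero    []       _ _ = here refl
∈-listsUpTo U (suc k) []       _ _ = here refl
∈-listsUpTo U (suc k) (x ∷ xs) (s≤s len) inU =
  there (∈-cartesianProductWith⁺ _∷_ (inU (here refl)) (∈-listsUpTo U k xs len (λ p → inU (there p))))

∈-─ : ∀ {A : Set} {x y : A} (ys : List A) (p : x ∈ ys) → y ∈ ys → ¬ y ≡ x → y ∈ ys ─ p
∈-─ (z ∷ ys) (here refl) (here refl) y≢x = ⊥-elim (y≢x refl)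
∈-─ (z ∷ ys) (here refl) (there q)   _   = q
∈-─ (z ∷ ys) (there p)   (here e)    _   = here e
∈-─ (z ∷ ys) (there p)   (there q)   y≢x = there (∈-─ ys p q y≢x)

unique-length : ∀ {A : Set} (xs ys : List A) → Unique xs → (∀ {x} → x ∈ xs → x ∈ ys) → length xs ≤ length ys
unique-length []       ys _             _   = z≤n
unique-length (x ∷ xs) ys (x∉xs ∷ uniq) sub = ≤-trans (s≤s rest) (≤-reflexive (sym (length-removeAt′ ys _)))
  where
  x∈ys : x ∈ ys
  x∈ys = sub (here refl)
  rest : length xs ≤ length (ys ─ x∈ys)
  rest = unique-length xs (ys ─ x∈ys) uniq
    (λ {y} y∈xs → ∈-─ ys x∈ys (sub (there y∈xs)) (λ y≡x → All.lookup x∉xs y∈xs (sym y≡x)))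

spanningPath-listed : ∀ {m} (p : List (V m)) → IsSpanningPath m p →
  p ∈ listsUpTo (allVertices m) (length (allVertices m))
spanningPath-listed {m} p (uniq , _ , _) =
  ∈-listsUpTo _ _ p (unique-length p (allVertices m) uniq (λ {v} _ → ∈-allVertices v)) (λ {v} _ → ∈-allVertices v)

isSpanningPath? : ∀ {m} (p : List (V m)) → Dec (IsSpanningPath m p)
isSpanningPath? {m} p =
  allPairs? (λ u v → ¬? (u ≟V v)) p ×-dec covers? ×-dec linked? (λ u v → ¬? (pair u ≟F pair v)) p
  where
  covers? : Dec (∀ v → v ∈ p)
  covers? with All.all? (λ v → Any.any? (v ≟V_) p) (allVertices m)
  ... | yes all = yes (λ v → All.lookup all (∈-allVertices v))
  ... | no ¬all = no (λ covers → ¬all (All.tabulate (λ {v} _ → covers v)))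

spanningPathClasses : ∀ m → ∃ λ k → PathUnfoldingCount m k
spanningPathClasses m =
  ClassCounting.classCount (IsSpanningPath m) (EquivPath m) isSpanningPath? equivPath? equiv-refl equiv-sym
    _ spanningPath-listed

-- Bracketing.

shift : ∀ {n} → V n → V (suc n)
shift (i , b) = fsuc i , b

shift-injective : ∀ {n} {u v : V n} → shift u ≡ shift v → u ≡ v
shift-injective {u = i , b} {j , c} e with fsuc-injective (cong proj₁ e) | cong proj₂ e
... | refl | refl = refl

shifted-avoids-0 : ∀ {n} {v : V (suc n)} {p : List (V n)} → v ∈ map shift p → ¬ pair v ≡ fzero
shifted-avoids-0 v∈ with ∈-map⁻ shift v∈
... | _ , _ , refl = λ ()

frame : ∀ {n} → Bool → List (V n) → List (V (suc n))
frame b p = (fzero , b) ∷ map shift p ++ [ (fzero , not b) ]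

bracket : ∀ {n} → List (V n) → List (V (suc n))
bracket = frame false

reverse-bracket : ∀ {n} (p : List (V n)) → reverse (bracket p) ≡ frame true (reverse p)
reverse-bracket p = begin
  reverse (bracket p)
    ≡⟨ unfold-reverse (fzero , false) (map shift p ++ [ (fzero , true) ]) ⟩
  reverse (map shift p ++ [ (fzero , true) ]) ∷ʳ (fzero , false)
    ≡⟨ cong (_∷ʳ (fzero , false)) (reverse-++ (map shift p) [ (fzero , true) ]) ⟩
  ((fzero , true) ∷ reverse (map shift p)) ∷ʳ (fzero , false)
    ≡⟨ cong (λ q → ((fzero , true) ∷ q) ∷ʳ (fzero , false)) (sym (reverse-map shift p)) ⟩
  frame true (reverse p)
    ∎

bracket-antipodal : ∀ {n} (p : List (V (suc n))) → IsSpanningPath (suc n) p →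
  IsAntipodalSpanningPath (suc (suc n)) (bracket p)
bracket-antipodal {n} p@(x ∷ p′) (uniq , covers , linked) =
  (All.tabulate head-fresh ∷ body-unique , covers′ , (λ ()) ∷ body-linked x p′ linked) ,
  (fzero , false) , (fzero , true) , map shift p , refl , refl , refl
  where
  head-fresh : ∀ {v} → v ∈ map shift p ++ [ (fzero , true) ] → ¬ (fzero , false) ≡ v
  head-fresh v∈ with ∈-++⁻ (map shift p) v∈
  ... | inj₁ v∈p = λ e → shifted-avoids-0 v∈p (cong pair (sym e))
  ... | inj₂ (here refl) = λ ()
  body-unique : Unique (map shift p ++ [ (fzero , true) ])
  body-unique = UniqueP.++⁺ (UniqueP.map⁺ shift-injective uniq) ([] ∷ [])
    (λ { (v∈p , here refl) → shifted-avoids-0 v∈p refl })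
  covers′ : ∀ v → v ∈ bracket p
  covers′ (fzero , false) = here refl
  covers′ (fzero , true)  = there (∈-++⁺ʳ (map shift p) (here refl))
  covers′ (fsuc i , b)    = there (∈-++⁺ˡ (∈-map⁺ shift (covers (i , b))))
  body-linked : ∀ y q → Linked (Adj (suc n)) (y ∷ q) →
    Linked (Adj (suc (suc n))) (map shift (y ∷ q) ++ [ (fzero , true) ])
  body-linked y []      _       = (λ ()) ∷ [-]
  body-linked y (z ∷ q) (r ∷ l) = (λ e → r (fsuc-injective e)) ∷ body-linked z q l
bracket-antipodal [] (_ , covers , _) with covers (fzero , false)
... | ()

unique-++⁻ˡ : ∀ {A : Set} (xs : List A) {ys} → Unique (xs ++ ys) → Unique xs
unique-++⁻ˡ []       _           = []
unique-++⁻ˡ (x ∷ xs) (x∉ ∷ uniq) = AllP.++⁻ˡ xs x∉ ∷ unique-++⁻ˡ xs uniq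

linked-++⁻ˡ : ∀ {A : Set} {R : A → A → Set} (xs : List A) {ys} → Linked R (xs ++ ys) → Linked R xs
linked-++⁻ˡ []           _       = []
linked-++⁻ˡ (x ∷ [])     _       = [-]
linked-++⁻ˡ (x ∷ y ∷ xs) (r ∷ l) = r ∷ linked-++⁻ˡ (y ∷ xs) l

avoids-0 : ∀ {n} (v : V (suc n)) → ¬ (fzero , false) ≡ v → ¬ v ≡ (fzero , true) → ¬ pair v ≡ fzero
avoids-0 (fzero , false) v≢0f _   _ = v≢0f refl
avoids-0 (fzero , true)  _   v≢0t _ = v≢0t refl
avoids-0 (fsuc i , _)    _   _    ()

middle-avoids-0 : ∀ {n} (mid : List (V (suc n))) →
  All (λ v → ¬ (fzero , false) ≡ v) (mid ++ [ (fzero , true) ]) → Unique (mid ++ [ (fzero , true) ]) →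
  All (λ v → ¬ pair v ≡ fzero) mid
middle-avoids-0 []        _         _           = []
middle-avoids-0 (v ∷ mid) (v≢ ∷ ≢s) (v∉ ∷ uniq) =
  avoids-0 v v≢ (All.lookup v∉ (∈-++⁺ʳ mid (here refl))) ∷ middle-avoids-0 mid ≢s uniq

unshift : ∀ {n} (mid : List (V (suc n))) → All (λ v → ¬ pair v ≡ fzero) mid → ∃ λ p → mid ≡ map shift p
unshift []                   _          = [] , refl
unshift ((fzero , b) ∷ mid)  (≢0 ∷ _)   = ⊥-elim (≢0 refl)
unshift ((fsuc i , b) ∷ mid) (_ ∷ ≢0s) with unshift mid ≢0s
... | p , refl = (i , b) ∷ p , refl

unbracket : ∀ {n} (mid : List (V (suc n))) →
  IsSpanningPath (suc n) ((fzero , false) ∷ mid ++ [ (fzero , true) ]) →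
  ∃ λ p → IsSpanningPath n p × mid ≡ map shift p
unbracket mid (head-fresh ∷ uniq , covers , linked) with unshift mid (middle-avoids-0 mid head-fresh uniq)
... | p , refl = p , (UniqueP.map⁻ (unique-++⁻ˡ (map shift p) uniq) , covers′ , linked′) , refl
  where
  covers′ : ∀ v → v ∈ p
  covers′ v with covers (shift v)
  ... | there v∈ with ∈-++⁻ (map shift p) v∈
  ...   | inj₁ v∈p with ∈-map⁻ shift v∈p
  ...     | u , u∈p , e = subst (_∈ p) (sym (shift-injective e)) u∈p
  covers′ v | there v∈ | inj₂ (here ())
  linked′ : Linked (Adj _) p
  linked′ = Linked.map (λ r e → r (cong fsuc e))
    (LinkedP.map⁻ (linked-++⁻ˡ (map shift p) (Linked.tail linked)))

-- The canonical form of a framed path: the labels of p move up by one to make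
-- room for the new pair 0, which opens the sequence and closes it with its other vertex.
wrap : List (ℕ × Bool) → List (ℕ × Bool)
wrap c = (0 , false) ∷ map (map₁ suc) c ++ [ (0 , true) ]

wrap-injective : ∀ {c d} → wrap c ≡ wrap d → c ≡ d
wrap-injective {c} {d} e =
  map-injective (cong (map₁ pred)) (∷ʳ-injectiveˡ (map (map₁ suc) c) (map (map₁ suc) d) (∷-injectiveʳ e))

module ShiftRelabel {n} = Relabel {n} {suc n} shift (λ _ _ → cong fsuc) (λ _ _ → fsuc-injective) shift-injective

canonFrom-frame : ∀ {n} b (seen xs : List (V n)) →
  canonFrom ((fzero , b) ∷ map shift seen) (map shift xs ++ [ (fzero , not b) ]) ≡
  map (map₁ suc) (canonFrom seen xs) ++ [ (0 , true) ]
canonFrom-frame {n} b seen []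
  rewrite dec-true (fzero {n} ≟F fzero) refl
        | dec-false (_≟V_ {suc n} (fzero , not b) (fzero , b)) (λ e → not-¬ refl (sym (cong proj₂ e))) = refl
canonFrom-frame b seen (x ∷ xs)
  rewrite dec-false (fsuc (pair x) ≟F fzero) (λ ()) | ShiftRelabel.firstInPair-map x seen
  with firstInPair x seen
... | just (j , s)
  rewrite does-⇔ (mk⇔ shift-injective (cong shift)) (shift x ≟V shift s) (x ≟V s) =
  cong (_ ∷_) (canonFrom-frame b seen xs)
... | nothing rewrite length-map shift seen =
  cong (_ ∷_) (trans (cong (λ q → canonFrom ((fzero , b) ∷ q) (map shift xs ++ [ (fzero , not b) ]))
                           (sym (map-++ shift seen [ x ])))
                     (canonFrom-frame b (seen ++ [ x ]) xs))

canon-frame : ∀ {n} b (p : List (V n)) → canon (frame b p) ≡ wrap (canon p)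
canon-frame b p = cong (_ ∷_) (canonFrom-frame b [] p)

-- Bracketing matches canonical forms exactly, so it preserves and reflects equivalence.
bracket-canonMatch : ∀ {n} {p q : List (V n)} → CanonMatch (bracket p) (bracket q) → CanonMatch p q
bracket-canonMatch {p = p} {q} (inj₁ e) =
  inj₁ (wrap-injective (trans (sym (canon-frame false p)) (trans e (canon-frame false q))))
bracket-canonMatch {p = p} {q} (inj₂ e) = inj₂ (wrap-injective (begin
  wrap (canon p)                ≡⟨ sym (canon-frame false p) ⟩
  canon (bracket p)             ≡⟨ e ⟩
  canon (reverse (bracket q))   ≡⟨ cong canon (reverse-bracket q) ⟩
  canon (frame true (reverse q)) ≡⟨ canon-frame true (reverse q) ⟩
  wrap (canon (reverse q))      ∎))

canonMatch-bracket : ∀ {n} {p q : List (V n)} → CanonMatch p q → CanonMatch (bracket p) (bracket q)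
canonMatch-bracket {p = p} {q} (inj₁ e) =
  inj₁ (trans (canon-frame false p) (trans (cong wrap e) (sym (canon-frame false q))))
canonMatch-bracket {p = p} {q} (inj₂ e) = inj₂ (begin
  canon (bracket p)             ≡⟨ canon-frame false p ⟩
  wrap (canon p)                ≡⟨ cong wrap e ⟩
  wrap (canon (reverse q))      ≡⟨ sym (canon-frame true (reverse q)) ⟩
  canon (frame true (reverse q)) ≡⟨ cong canon (sym (reverse-bracket q)) ⟩
  canon (reverse (bracket q))   ∎)

bracket-reflects : ∀ {n} (p q : List (V n)) → EquivPath (suc n) (bracket p) (bracket q) → EquivPath n p q
bracket-reflects p q r = canon⇒equiv (bracket-canonMatch (equiv⇒canon r))

bracket-preserves : ∀ {n} (p q : List (V n)) → EquivPath n p q → EquivPath (suc n) (bracket p) (bracket q)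
bracket-preserves p q r = canon⇒equiv (canonMatch-bracket (equiv⇒canon r))

-- Every spanning path with antipodal endpoints is equivalent to a bracketed one:
-- the swap sending its first vertex (i , b) to (0 , false) sends the last one,
-- (i , not b), to (0 , true).
antipodal-bracketed : ∀ {n} (x : List (V (suc n))) → IsAntipodalSpanningPath (suc n) x →
  ∃ λ p → IsSpanningPath n p × EquivPath (suc n) x (bracket p)
antipodal-bracketed {n} _ (spanning , (i , b) , (.i , .(not b)) , mid , refl , refl , refl) =
  finish (unbracket (map (apply τ) mid) (subst (IsSpanningPath (suc n)) moved (spanning-apply τ _ spanning)))
  where
  τ : Automorphism (suc n)
  τ = swapAut i fzero b
  first : apply τ (i , b) ≡ (fzero , false)
  first = trans (swap-moves i fzero b b) (cong (fzero ,_) (xor-same b))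
  last : apply τ (i , not b) ≡ (fzero , true)
  last = trans (swap-moves i fzero b (not b)) (cong (fzero ,_) (xor-inverseʳ b))
  moved : map (apply τ) ((i , b) ∷ mid ++ [ (i , not b) ]) ≡ (fzero , false) ∷ map (apply τ) mid ++ [ (fzero , true) ]
  moved = cong₂ _∷_ first (trans (map-++ (apply τ) mid [ (i , not b) ]) (cong (λ v → map (apply τ) mid ++ [ v ]) last))
  finish : (∃ λ p → IsSpanningPath n p × map (apply τ) mid ≡ map shift p) →
    ∃ λ p → IsSpanningPath n p × EquivPath (suc n) ((i , b) ∷ mid ++ [ (i , not b) ]) (bracket p)
  finish (p , p-spanning , mid≡) =
    p , p-spanning , τ , inj₁ (trans moved (cong (λ q → (fzero , false) ∷ q ++ [ (fzero , true) ]) mid≡))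

bracket-classes : ∀ n {k} → PathUnfoldingCount (suc n) k → AntipodalPathCount (suc (suc n)) k
bracket-classes n = classCount-transfer
  {P = IsSpanningPath (suc n)} {IsAntipodalSpanningPath (suc (suc n))} {EquivPath (suc n)} {EquivPath (suc (suc n))}
  bracket bracket-antipodal bracket-reflects bracket-preserves
  antipodal-bracketed equiv-trans

-- The theorem: count the spanning paths of the n-Roberts graph up to
-- equivalence and transfer the count along bracketing (which needs only n ≥ 1).
mainTheorem8 : (n : ℕ) → 2 ≤ n →
    ∃ λ k → PathUnfoldingCount n k × AntipodalPathCount (suc n) k
mainTheorem8 zero ()
mainTheorem8 (suc n) _ with spanningPathClasses (suc n)
... | k , classes = k , classes , bracket-classes n classes
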